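{- For all compositions $\alpha$ and $\beta$, \[\mathcal{H}(\alpha\cdot\beta)=\frac{y}{y+z}\left(\mathcal{H}(\alpha)+\mathcal{H}(\beta)\right)+\frac{z}{y+z}\,\mathcal{H}(\alpha\odot\beta).\]
   Context: A composition is a finite sequence $\alpha=(a_1,\dots,a_k)$ of positive integers. Its length is $\ell(\alpha)=k$ and its size is $|\alpha|=\sum a_i$. For compositions $\gamma,\alpha$ of the same size, $\gamma$ is a coarsening of $\alpha$, written $\gamma\ge\alpha$, if every partial sum $g_1+\dots+g_j$ of $\gamma$ is also a partial sum of $\alpha$. For $\alpha=(a_1,\dots,a_k)$ and $\beta=(b_1,\dots,b_m)$, the concatenation is $\alpha\cdot\beta=(a_1,\dots,a_k,b_1,\dots,b_m)$ and the near-concatenation is $\alpha\odot\beta=(a_1,\dots,a_{k-1},a_k+b_1,b_2,\dots,b_m)$. With indeterminates $y,z,x_1,x_2,\dots$, define \[\mathcal{H}(\alpha)=\sum_{\gamma\ge\alpha}\frac{y^{\ell(\gamma)-1}z^{\ell(\alpha)-\ell(\gamma)}}{(y+z)^{\ell(\alpha)-1}}\sum_{i=1}^{\ell(\gamma)}x_{\gamma_i},\] where $\gamma_i$ is the $i$th part of $\gamma$. -}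

module Defs where

open import Level using (Level)
open import Data.Nat using (ℕ; zero; suc; _+_; _∸_; _≟_; _<_)
open import Data.List using (List; []; _∷_; _++_; map; concatMap; upTo; filter; length; foldr)
open import Data.Nat.ListAction using (sum)
open import Data.List.Relation.Unary.All as All using (All)
open import Data.List.Membership.DecPropositional _≟_ using (_∈_; _∈?_)
open import Data.Product using (_×_)
open import Relation.Binary.PropositionalEquality using (_≡_)
open import Relation.Nullary.Decidable using (Dec; _×-dec_)
open import Algebra.Bundles using (CommutativeRing)

-- A composition: a nonempty finite list of positive integers.
-- (Nonemptiness is needed: H(α) has (y+z)^(ℓ(α)-1) in the denominator and
-- the near-concatenation α ⊙ β refers to the last part of α / first part of β.)
data NonEmpty : List ℕ → Set where
  nonEmpty : ∀ {a as} → NonEmpty (a ∷ as)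

IsComposition : List ℕ → Set
IsComposition α = NonEmpty α × All (0 <_) α

-- concatenation α · β is list append _++_.

-- near-concatenation α ⊙ β = (a₁,…,a_{k-1}, a_k + b₁, b₂,…,b_m)
_⊙_ : List ℕ → List ℕ → List ℕ
[] ⊙ β = β
(a ∷ []) ⊙ [] = a ∷ []
(a ∷ []) ⊙ (b ∷ bs) = (a + b) ∷ bs
(a ∷ a′ ∷ as) ⊙ β = a ∷ ((a′ ∷ as) ⊙ β)

partialSums : List ℕ → List ℕ
partialSums [] = []
partialSums (g ∷ gs) = g ∷ map (g +_) (partialSums gs)

_≽_ : List ℕ → List ℕ → Set
γ ≽ α = sum γ ≡ sum α × All (_∈ partialSums α) (partialSums γ)

_≽?_ : ∀ γ α → Dec (γ ≽ α)
γ ≽? α = (sum γ ≟ sum α) ×-dec All.all? (_∈? partialSums α) (partialSums γ)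

listsOf : ℕ → ℕ → List (List ℕ)
listsOf n zero = [] ∷ []
listsOf n (suc k) = concatMap (λ a → map (a ∷_) (listsOf n k)) (map suc (upTo n))

-- all lists of length in {1,…,n} with entries in {1,…,n}; this contains every
-- composition of size n (each distinct one exactly once)
candidates : ℕ → List (List ℕ)
candidates n = concatMap (listsOf n) (map suc (upTo n))

coarsenings : List ℕ → List (List ℕ)
coarsenings α = filter (λ γ → γ ≽? α) (candidates (sum α))

-- H(α), evaluated in a commutative ring R at y, z, x_i, where w is an inverse of y + z.
module HDef {c ℓ : Level} (R : CommutativeRing c ℓ) where
  open CommutativeRing R using (Carrier; _*_; 0#; 1#) renaming (_+_ to _⊕_)

  pow : Carrier → ℕ → Carrier
  pow a zero = 1#
  pow a (suc k) = a * pow a k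

  Σ : List Carrier → Carrier
  Σ = foldr _⊕_ 0#

  H : (y z w : Carrier) (x : ℕ → Carrier) → List ℕ → Carrier
  H y z w x α = Σ (map term (coarsenings α))
    where
    term : List ℕ → Carrier
    term γ = (pow y (length γ ∸ 1) * pow z (length α ∸ length γ) * pow w (length α ∸ 1))
             * Σ (map x γ)

-- Every coarsening of c ∷ a ∷ as either keeps c as its first part, followed by a
-- coarsening of a ∷ as, or merges c into the next part, i.e. is a coarsening of
-- (c + a) ∷ as.  Clearing denominators, N(α) = (y+z)^(ℓ(α)-1) H(α) therefore satisfies
--   N(c ∷ a ∷ as) = y (x_c (y+z)^ℓ(as) + N(a ∷ as)) + z N((c + a) ∷ as),
-- where the x_c term uses that the weights y^(ℓ(γ)-1) z^(ℓ(α)-ℓ(γ)) of the coarsenings γ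
-- of α sum to (y+z)^(ℓ(α)-1).  Induction on α along this recursion gives
--   N(α · β) = y (N(α) (y+z)^(ℓ(β)-1) + (y+z)^(ℓ(α)-1) N(β)) + z N(α ⊙ β),
-- and dividing by (y+z)^(ℓ(α)+ℓ(β)-1) yields the claim.

{-# OPTIONS --safe #-}
module Submission where

open import Defs
open import Level using (Level)
open import Data.Nat using (ℕ)
open import Data.List using (List; _∷_; _++_; length)
open import Algebra.Bundles using (CommutativeRing)
open import Data.List.Relation.Unary.All using (_∷_)
import Data.List.Relation.Unary.All.Properties as All
open import Data.Product using (_,_)
import Relation.Binary.Reasoning.Setoid

module Coarsening where

  open import Data.Nat using (zero; suc; _+_; _≤_; _<_; z≤n; s≤s)
  open import Data.Nat.Properties
  open import Data.Nat.ListAction using (sum)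
  open import Data.List using ([]; map; concatMap; upTo)
  open import Data.List.Properties using (∷-injectiveʳ)
  open import Data.List.Relation.Unary.All as All using (All; [])
  open import Data.List.Relation.Unary.Any using (here; there)
  open import Data.List.Membership.Propositional using (_∈_; find; lose)
  open import Data.List.Membership.Propositional.Properties
  open import Data.List.Membership.Propositional.Properties.WithK using (unique∧set⇒bag)
  open import Data.List.Relation.Unary.Unique.Propositional using (Unique; []; _∷_)
  import Data.List.Relation.Unary.Unique.Propositional.Properties as Unique
  open import Data.List.Relation.Binary.Permutation.Propositional using (_↭_)
  open import Data.List.Relation.Binary.BagAndSetEquality using (∼bag⇒↭)
  open import Data.Product using (_×_; proj₁; proj₂)
  open import Data.Sum using (inj₁; inj₂)
  open import Data.Empty using (⊥-elim)
  open import Function using (_∘_)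
  open import Function.Bundles using (mk⇔)
  open import Relation.Nullary using (¬_; yes; no)
  open import Relation.Binary.PropositionalEquality

  Positive : List ℕ → Set
  Positive = All (0 <_)

  Unique-concatMap⁺ : {A B : Set} (f : A → List B) (key : B → A) →
                      (∀ a {b} → b ∈ f a → key b ≡ a) → (∀ a → Unique (f a)) →
                      ∀ {xs} → Unique xs → Unique (concatMap f xs)
  Unique-concatMap⁺ f key key-f f-unique {[]}     []               = []
  Unique-concatMap⁺ f key key-f f-unique {a ∷ xs} (a∉xs ∷ xs-unique) =
    Unique.++⁺ (f-unique a) (Unique-concatMap⁺ f key key-f f-unique xs-unique) disjoint
    where
    disjoint : ∀ {b} → ¬ (b ∈ f a × b ∈ concatMap f xs)
    disjoint (b∈fa , b∈rest) =
      let a′ , a′∈xs , b∈fa′ = find (∈-concatMap⁻ f b∈rest)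
      in All.lookup a∉xs a′∈xs (trans (sym (key-f a b∈fa)) (key-f a′ b∈fa′))

  ∈-map-suc-upTo⁺ : ∀ {n e} → 0 < e → e ≤ n → e ∈ map suc (upTo n)
  ∈-map-suc-upTo⁺ {e = suc e} _ e<n = ∈-map⁺ suc (∈-upTo⁺ e<n)

  length≤sum : ∀ γ → Positive γ → length γ ≤ sum γ
  length≤sum []      []       = z≤n
  length≤sum (g ∷ γ) (pg ∷ pγ) = +-mono-≤ pg (length≤sum γ pγ)

  parts≤sum : ∀ γ → All (_≤ sum γ) γ
  parts≤sum []      = []
  parts≤sum (g ∷ γ) =
    m≤m+n g (sum γ) ∷ All.map (λ e≤ → ≤-trans e≤ (m≤n+m (sum γ) g)) (parts≤sum γ)

  head : List ℕ → ℕ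
  head []      = 0
  head (g ∷ _) = g

  ∈-listsOf⁻ : ∀ n k {γ} → γ ∈ listsOf n k → Positive γ × length γ ≡ k
  ∈-listsOf⁻ n zero (here refl) = [] , refl
  ∈-listsOf⁻ n (suc k) γ∈
    with find (∈-concatMap⁻ (λ a → map (a ∷_) (listsOf n k)) {xs = map suc (upTo n)} γ∈)
  ... | a , a∈ , γ∈a with ∈-map⁻ suc a∈ | ∈-map⁻ (a ∷_) γ∈a
  ... | _ , _ , refl | γ′ , γ′∈ , refl =
    let pγ′ , len = ∈-listsOf⁻ n k γ′∈ in s≤s z≤n ∷ pγ′ , cong suc len

  ∈-listsOf⁺ : ∀ n γ → All (_∈ map suc (upTo n)) γ → γ ∈ listsOf n (length γ)
  ∈-listsOf⁺ n []      []          = here refl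
  ∈-listsOf⁺ n (g ∷ γ) (g∈ ∷ γ∈s) =
    ∈-concatMap⁺ (λ a → map (a ∷_) (listsOf n (length γ)))
      (lose g∈ (∈-map⁺ (g ∷_) (∈-listsOf⁺ n γ γ∈s)))

  listsOf-unique : ∀ n k → Unique (listsOf n k)
  listsOf-unique n zero    = [] ∷ []
  listsOf-unique n (suc k) =
    Unique-concatMap⁺ (λ a → map (a ∷_) (listsOf n k)) head head-cons
      (λ _ → Unique.map⁺ ∷-injectiveʳ (listsOf-unique n k))
      (Unique.map⁺ suc-injective (Unique.upTo⁺ n))
    where
    head-cons : ∀ a {γ} → γ ∈ map (a ∷_) (listsOf n k) → head γ ≡ a
    head-cons a γ∈ with _ , _ , refl ← ∈-map⁻ (a ∷_) γ∈ = refl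

  candidates-unique : ∀ n → Unique (candidates n)
  candidates-unique n =
    Unique-concatMap⁺ (listsOf n) length (λ k γ∈ → proj₂ (∈-listsOf⁻ n k γ∈))
      (listsOf-unique n) (Unique.map⁺ suc-injective (Unique.upTo⁺ n))

  ∈-candidates⁻ : ∀ n {γ} → γ ∈ candidates n → Positive γ
  ∈-candidates⁻ n γ∈ with find (∈-concatMap⁻ (listsOf n) {xs = map suc (upTo n)} γ∈)
  ... | k , _ , γ∈k = proj₁ (∈-listsOf⁻ n k γ∈k)

  ∈-candidates⁺ : ∀ γ → NonEmpty γ → Positive γ → γ ∈ candidates (sum γ)
  ∈-candidates⁺ (g ∷ γ) nonEmpty pgγ@(pg ∷ pγ) =
    ∈-concatMap⁺ (listsOf (sum (g ∷ γ)))
      (lose (∈-map-suc-upTo⁺ (s≤s z≤n) (+-mono-≤ pg (length≤sum γ pγ)))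
            (∈-listsOf⁺ _ (g ∷ γ) (All.zipWith (λ (pe , e≤) → ∈-map-suc-upTo⁺ pe e≤)
                                               (pgγ , parts≤sum (g ∷ γ)))))

  head≤partialSums : ∀ g gs {p} → p ∈ partialSums (g ∷ gs) → g ≤ p
  head≤partialSums g gs (here refl) = ≤-refl
  head≤partialSums g gs (there p∈) with q , _ , refl ← ∈-map⁻ (g +_) p∈ = m≤m+n g q

  partialSums-positive : ∀ γ → Positive γ → Positive (partialSums γ)
  partialSums-positive []       _        = []
  partialSums-positive (g ∷ gs) (pg ∷ _) = All.tabulate (λ p∈ → ≤-trans pg (head≤partialSums g gs p∈))

  ∈-partialSums-∷⁺ : ∀ c α {p} → p ∈ partialSums α → c + p ∈ partialSums (c ∷ α)
  ∈-partialSums-∷⁺ c α p∈ = there (∈-map⁺ (c +_) p∈)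

  ∈-partialSums-∷⁻ : ∀ c α {p} → 0 < p → c + p ∈ partialSums (c ∷ α) → p ∈ partialSums α
  ∈-partialSums-∷⁻ c α pp (here c+p≡c) = ⊥-elim (<-irrefl (sym c+p≡c) (m<m+n c pp))
  ∈-partialSums-∷⁻ c α pp (there c+p∈) with q , q∈ , c+p≡c+q ← ∈-map⁻ (c +_) c+p∈
    rewrite +-cancelˡ-≡ c _ _ c+p≡c+q = q∈

  ∈-partialSums-merge⁺ : ∀ c a as {p} → p ∈ partialSums ((c + a) ∷ as) → p ∈ partialSums (c ∷ a ∷ as)
  ∈-partialSums-merge⁺ c a as (here refl) = ∈-partialSums-∷⁺ c (a ∷ as) (here refl)
  ∈-partialSums-merge⁺ c a as (there p∈) with q , q∈ , refl ← ∈-map⁻ ((c + a) +_) p∈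
    rewrite +-assoc c a q = ∈-partialSums-∷⁺ c (a ∷ as) (∈-partialSums-∷⁺ a as q∈)

  ∈-partialSums-merge⁻ : ∀ c a as {p} → c < p → p ∈ partialSums (c ∷ a ∷ as) →
                         p ∈ partialSums ((c + a) ∷ as)
  ∈-partialSums-merge⁻ c a as c<c (here refl) = ⊥-elim (<-irrefl refl c<c)
  ∈-partialSums-merge⁻ c a as _ (there p∈) with q , q∈ , refl ← ∈-map⁻ (c +_) p∈ with q∈
  ... | here refl = here refl
  ... | there q∈′ with r , r∈ , refl ← ∈-map⁻ (a +_) q∈′
    rewrite sym (+-assoc c a r) = ∈-partialSums-∷⁺ (c + a) as r∈

  ∷-≽ : ∀ c {γ α} → γ ≽ α → (c ∷ γ) ≽ (c ∷ α)
  ∷-≽ c {α = α} (sum≡ , γ⊆α) =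
    cong (c +_) sum≡ , here refl ∷ All.map⁺ (All.map (∈-partialSums-∷⁺ c α) γ⊆α)

  ∷-≽⁻ : ∀ c {γ α} → Positive γ → (c ∷ γ) ≽ (c ∷ α) → γ ≽ α
  ∷-≽⁻ c {γ} {α} pγ (sum≡ , _ ∷ cγ⊆cα) =
    +-cancelˡ-≡ c _ _ sum≡ ,
    All.zipWith (λ (pp , c+p∈) → ∈-partialSums-∷⁻ c α pp c+p∈)
                (partialSums-positive γ pγ , All.map⁻ cγ⊆cα)

  ≽-merge⁺ : ∀ c a as {γ} → γ ≽ ((c + a) ∷ as) → γ ≽ (c ∷ a ∷ as)
  ≽-merge⁺ c a as (sum≡ , γ⊆) =
    trans sum≡ (+-assoc c a (sum as)) , All.map (∈-partialSums-merge⁺ c a as) γ⊆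

  ≽-merge⁻ : ∀ c a as {g gs} → c < g → (g ∷ gs) ≽ (c ∷ a ∷ as) → (g ∷ gs) ≽ ((c + a) ∷ as)
  ≽-merge⁻ c a as {g} {gs} c<g (sum≡ , γ⊆) =
    trans sum≡ (sym (+-assoc c a (sum as))) ,
    All.tabulate (λ p∈ → ∈-partialSums-merge⁻ c a as (<-≤-trans c<g (head≤partialSums g gs p∈))
                                              (All.lookup γ⊆ p∈))

  -- The coarsenings of c ∷ as, split by whether the boundary after c is kept or merged away.
  coarseningsOf : ℕ → List ℕ → List (List ℕ)
  coarseningsOf c []       = (c ∷ []) ∷ []
  coarseningsOf c (a ∷ as) = map (c ∷_) (coarseningsOf a as) ++ coarseningsOf (c + a) as

  ∈-coarseningsOf⁻ : ∀ c as {γ} → 0 < c → Positive as → γ ∈ coarseningsOf c as →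
                     NonEmpty γ × Positive γ × γ ≽ (c ∷ as)
  ∈-coarseningsOf⁻ c []       pc _          (here refl) = nonEmpty , pc ∷ [] , refl , here refl ∷ []
  ∈-coarseningsOf⁻ c (a ∷ as) pc (pa ∷ pas) γ∈ with ∈-++⁻ (map (c ∷_) (coarseningsOf a as)) γ∈
  ... | inj₁ γ∈kept with γ′ , γ′∈ , refl ← ∈-map⁻ (c ∷_) γ∈kept =
    let _ , pγ′ , γ′≽ = ∈-coarseningsOf⁻ a as pa pas γ′∈ in nonEmpty , pc ∷ pγ′ , ∷-≽ c γ′≽
  ... | inj₂ γ∈merged =
    let ne , pγ , γ≽ = ∈-coarseningsOf⁻ (c + a) as (≤-trans pc (m≤m+n c a)) pas γ∈merged
    in ne , pγ , ≽-merge⁺ c a as γ≽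

  ∈-coarseningsOf⁺ : ∀ c as {γ} → 0 < c → Positive as → Positive γ → γ ≽ (c ∷ as) →
                     γ ∈ coarseningsOf c as
  ∈-coarseningsOf⁺ c as {[]} pc _ _ (0≡c+s , _) = ⊥-elim (<-irrefl 0≡c+s (≤-trans pc (m≤m+n c (sum as))))
  ∈-coarseningsOf⁺ c [] {g ∷ []} _ _ _ (_ , here refl ∷ []) = here refl
  ∈-coarseningsOf⁺ c [] {g ∷ g′ ∷ gs} _ _ (_ ∷ pg′ ∷ _) (_ , here refl ∷ c+g′∈ ∷ _)
    with () ← ∈-partialSums-∷⁻ c [] pg′ c+g′∈
  ∈-coarseningsOf⁺ c (a ∷ as) {g ∷ gs} pc (pa ∷ pas) (pg ∷ pgs) γ≽@(_ , g∈ ∷ _) with g ≟ c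
  ... | yes refl = ∈-++⁺ˡ (∈-map⁺ (c ∷_) (∈-coarseningsOf⁺ a as pa pas pgs (∷-≽⁻ c pgs γ≽)))
  ... | no g≢c =
    ∈-++⁺ʳ (map (c ∷_) (coarseningsOf a as))
      (∈-coarseningsOf⁺ (c + a) as (≤-trans pc (m≤m+n c a)) pas (pg ∷ pgs) (≽-merge⁻ c a as c<g γ≽))
    where
    c<g : c < g
    c<g = ≤∧≢⇒< (head≤partialSums c (a ∷ as) g∈) (g≢c ∘ sym)

  coarseningsOf-unique : ∀ c as → Positive as → Unique (coarseningsOf c as)
  coarseningsOf-unique c []         _          = [] ∷ []
  coarseningsOf-unique c (a ∷ as) (pa ∷ pas) =
    Unique.++⁺ (Unique.map⁺ ∷-injectiveʳ (coarseningsOf-unique a as pas))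
               (coarseningsOf-unique (c + a) as pas) disjoint
    where
    disjoint : ∀ {γ} → ¬ (γ ∈ map (c ∷_) (coarseningsOf a as) × γ ∈ coarseningsOf (c + a) as)
    disjoint (γ∈kept , γ∈merged)
      with _ , _ , refl ← ∈-map⁻ (c ∷_) γ∈kept
      with _ , _ , _ , c∈ ∷ _ ← ∈-coarseningsOf⁻ (c + a) as (≤-trans pa (m≤n+m a c)) pas γ∈merged =
      <-irrefl refl (<-≤-trans (m<m+n c pa) (head≤partialSums (c + a) as c∈))

  coarsenings↭coarseningsOf : ∀ c as → 0 < c → Positive as → coarsenings (c ∷ as) ↭ coarseningsOf c as
  coarsenings↭coarseningsOf c as pc pas =
    ∼bag⇒↭ (unique∧set⇒bag (Unique.filter⁺ (_≽? (c ∷ as)) (candidates-unique (sum (c ∷ as))))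
                            (coarseningsOf-unique c as pas) (mk⇔ to from))
    where
    to : ∀ {γ} → γ ∈ coarsenings (c ∷ as) → γ ∈ coarseningsOf c as
    to γ∈ with γ∈cand , γ≽ ← ∈-filter⁻ (_≽? (c ∷ as)) {xs = candidates (sum (c ∷ as))} γ∈ =
      ∈-coarseningsOf⁺ c as pc pas (∈-candidates⁻ (sum (c ∷ as)) γ∈cand) γ≽
    from : ∀ {γ} → γ ∈ coarseningsOf c as → γ ∈ coarsenings (c ∷ as)
    from {γ} γ∈ =
      let ne , pγ , γ≽@(sum≡ , _) = ∈-coarseningsOf⁻ c as pc pas γ∈
      in ∈-filter⁺ (_≽? (c ∷ as))
                   (subst (λ n → γ ∈ candidates n) sum≡ (∈-candidates⁺ γ ne pγ)) γ≽

  length-∈-coarseningsOf : ∀ c as {γ} → γ ∈ coarseningsOf c as →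
                           NonEmpty γ × length γ ≤ suc (length as)
  length-∈-coarseningsOf c []       (here refl) = nonEmpty , ≤-refl
  length-∈-coarseningsOf c (a ∷ as) γ∈ with ∈-++⁻ (map (c ∷_) (coarseningsOf a as)) γ∈
  ... | inj₁ γ∈kept with γ′ , γ′∈ , refl ← ∈-map⁻ (c ∷_) γ∈kept =
    let _ , len≤ = length-∈-coarseningsOf a as γ′∈ in nonEmpty , s≤s len≤
  ... | inj₂ γ∈merged =
    let ne , len≤ = length-∈-coarseningsOf (c + a) as γ∈merged in ne , m≤n⇒m≤1+n len≤

  addToHead : ℕ → List ℕ → List ℕ
  addToHead c []       = []
  addToHead c (d ∷ ds) = (c + d) ∷ ds

  addToHead-⊙ : ∀ c a as β → addToHead c ((a ∷ as) ⊙ β) ≡ ((c + a) ∷ as) ⊙ β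
  addToHead-⊙ c a []       []       = refl
  addToHead-⊙ c a []       (b ∷ bs) = cong (_∷ bs) (sym (+-assoc c a b))
  addToHead-⊙ c a (_ ∷ _)  β        = refl

  ⊙-NonEmpty : ∀ a as β → NonEmpty ((a ∷ as) ⊙ β)
  ⊙-NonEmpty a []      []      = nonEmpty
  ⊙-NonEmpty a []      (_ ∷ _) = nonEmpty
  ⊙-NonEmpty a (_ ∷ _) β       = nonEmpty

  length-⊙ : ∀ a as b bs → length ((a ∷ as) ⊙ (b ∷ bs)) ≡ suc (length as + length bs)
  length-⊙ a []        b bs = refl
  length-⊙ a (a′ ∷ as) b bs = cong suc (length-⊙ a′ as b bs)

  ⊙-positive : ∀ α β → Positive α → Positive β → Positive (α ⊙ β)
  ⊙-positive []            β        _          pβ         = pβ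
  ⊙-positive (a ∷ [])      []       pα         _          = pα
  ⊙-positive (a ∷ [])      (b ∷ bs) (pa ∷ [])  (_ ∷ pbs)  = ≤-trans pa (m≤m+n a b) ∷ pbs
  ⊙-positive (a ∷ a′ ∷ as) β        (pa ∷ pα)  pβ         = pa ∷ ⊙-positive (a′ ∷ as) β pα pβ

module RingSums {c ℓ : Level} (R : CommutativeRing c ℓ) where

  open import Data.Nat as ℕ using (zero; suc; _∸_)
  open import Data.List using ([]; map)
  open import Data.List.Properties using (length-++)
  open import Data.List.Relation.Unary.Any using (here; there)
  open import Data.List.Membership.Propositional using (_∈_)
  open import Data.List.Relation.Binary.Permutation.Propositional as ↭ using (_↭_)
  open import Function using (_∘_)
  import Relation.Binary.PropositionalEquality as ≡
  open CommutativeRing R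
  open HDef R using (pow; Σ)
  import Algebra.Properties.CommutativeSemigroup as CommutativeSemigroupProperties
  open CommutativeSemigroupProperties +-commutativeSemigroup
    using () renaming (interchange to +-interchange; x∙yz≈y∙xz to x+[y+z]≈y+[x+z])
  open CommutativeSemigroupProperties *-commutativeSemigroup using () renaming (interchange to *-interchange)
  open import Algebra.Solver.Ring.NaturalCoefficients.Default commutativeSemiring
    using (solve; _:+_; _:*_; _:=_)
  open import Relation.Binary.Reasoning.Setoid setoid
  open Coarsening using (length-⊙)

  module _ {a} {A : Set a} where

    Σ-++ : ∀ (f : A → Carrier) xs ys → Σ (map f (xs ++ ys)) ≈ Σ (map f xs) + Σ (map f ys)
    Σ-++ f []       ys = sym (+-identityˡ _)
    Σ-++ f (x ∷ xs) ys = trans (+-congˡ (Σ-++ f xs ys)) (sym (+-assoc _ _ _))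

    Σ-cong : ∀ {f g : A → Carrier} xs → (∀ {x} → x ∈ xs → f x ≈ g x) → Σ (map f xs) ≈ Σ (map g xs)
    Σ-cong []       f≈g = refl
    Σ-cong (x ∷ xs) f≈g = +-cong (f≈g (here ≡.refl)) (Σ-cong xs (f≈g ∘ there))

    Σ-*ˡ : ∀ k (f : A → Carrier) xs → Σ (map (λ x → k * f x) xs) ≈ k * Σ (map f xs)
    Σ-*ˡ k f []       = sym (zeroʳ k)
    Σ-*ˡ k f (x ∷ xs) = trans (+-congˡ (Σ-*ˡ k f xs)) (sym (distribˡ k _ _))

    Σ-+ : ∀ (f g : A → Carrier) xs → Σ (map (λ x → f x + g x) xs) ≈ Σ (map f xs) + Σ (map g xs)
    Σ-+ f g []       = sym (+-identityˡ 0#)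
    Σ-+ f g (x ∷ xs) = trans (+-congˡ (Σ-+ f g xs)) (+-interchange _ _ _ _)

    Σ-↭ : ∀ (f : A → Carrier) {xs ys} → xs ↭ ys → Σ (map f xs) ≈ Σ (map f ys)
    Σ-↭ f ↭.refl          = refl
    Σ-↭ f (↭.prep _ p)    = +-congˡ (Σ-↭ f p)
    Σ-↭ f (↭.swap _ _ p)  = trans (+-congˡ (+-congˡ (Σ-↭ f p))) (x+[y+z]≈y+[x+z] _ _ _)
    Σ-↭ f (↭.trans p q)   = trans (Σ-↭ f p) (Σ-↭ f q)

  pow-+ : ∀ u m n → pow u (m ℕ.+ n) ≈ pow u m * pow u n
  pow-+ u zero    n = sym (*-identityˡ _)
  pow-+ u (suc m) n = trans (*-congˡ (pow-+ u m n)) (sym (*-assoc _ _ _))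

  pow-length-++ : ∀ u {a} {A : Set a} (xs ys : List A) →
                  pow u (length (xs ++ ys)) ≈ pow u (length xs) * pow u (length ys)
  pow-length-++ u xs ys = trans (reflexive (≡.cong (pow u) (length-++ xs))) (pow-+ u (length xs) _)

  pow-length-⊙ : ∀ u a as b bs →
                 pow u (length ((a ∷ as) ⊙ (b ∷ bs)) ∸ 1) ≈ pow u (length as) * pow u (length bs)
  pow-length-⊙ u a as b bs =
    trans (reflexive (≡.cong (λ l → pow u (l ∸ 1)) (length-⊙ a as b bs))) (pow-+ u (length as) _)

  pow-inverse : ∀ {u v} → u * v ≈ 1# → ∀ n → pow u n * pow v n ≈ 1#
  pow-inverse uv≈1 zero    = *-identityˡ 1#
  pow-inverse uv≈1 (suc n) = begin
    (_ * pow _ n) * (_ * pow _ n) ≈⟨ *-interchange _ _ _ _ ⟩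
    (_ * _) * (pow _ n * pow _ n) ≈⟨ *-cong uv≈1 (pow-inverse uv≈1 n) ⟩
    1# * 1#                       ≈⟨ *-identityˡ 1# ⟩
    1#                            ∎

  rescale-by-inverses : ∀ {u v p q} → u * p ≈ 1# → v * q ≈ 1# → ∀ w y z A B C →
    (u * (w * v)) * (y * (A * q + p * B) + z * C) ≈ (y * w) * (u * A + v * B) + (z * w) * ((u * v) * C)
  rescale-by-inverses {u} {v} {p} {q} up≈1 vq≈1 w y z A B C = begin
    (u * (w * v)) * (y * (A * q + p * B) + z * C)
      ≈⟨ solve 10 (λ U W V Y Z A B C P Q →
           (U :* (W :* V)) :* (Y :* (A :* Q :+ P :* B) :+ Z :* C)
           := (Y :* W) :* (U :* A :* (V :* Q) :+ V :* B :* (U :* P)) :+ (Z :* W) :* ((U :* V) :* C))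
         refl u w v y z A B C p q ⟩
    (y * w) * (u * A * (v * q) + v * B * (u * p)) + (z * w) * ((u * v) * C)
      ≈⟨ +-congʳ (*-congˡ (+-cong (trans (*-congˡ vq≈1) (*-identityʳ _))
                                  (trans (*-congˡ up≈1) (*-identityʳ _)))) ⟩
    (y * w) * (u * A + v * B) + (z * w) * ((u * v) * C) ∎

module Numerator {c ℓ : Level} (R : CommutativeRing c ℓ)
                 (y z : CommutativeRing.Carrier R) (x : ℕ → CommutativeRing.Carrier R) where

  open import Data.Nat as ℕ using (suc; _∸_; _≤_)
  open import Data.Nat.Properties using (+-∸-assoc)
  open import Data.List using ([]; map)
  open import Data.List.Properties using (map-∘)
  open import Data.List.Membership.Propositional using (_∈_)
  open import Data.Product using (proj₁; proj₂)
  open import Function using (_∘_)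
  import Relation.Binary.PropositionalEquality as ≡
  open Coarsening
  open CommutativeRing R
  open HDef R using (pow; Σ; H)
  open RingSums R
  open import Algebra.Properties.CommutativeSemigroup *-commutativeSemigroup
    using () renaming (x∙yz≈y∙xz to x*[y*z]≈y*[x*z]; xy∙z≈y∙xz to x*y*z≈y*[x*z])
  open import Algebra.Solver.Ring.NaturalCoefficients.Default commutativeSemiring
    using (solve; _:+_; _:*_; _:=_)
  open import Relation.Binary.Reasoning.Setoid setoid

  weight : ℕ → List ℕ → Carrier
  weight k γ = pow y (length γ ∸ 1) * pow z (k ∸ length γ)

  term : ℕ → List ℕ → Carrier
  term k γ = weight k γ * Σ (map x γ)

  numerator : List ℕ → Carrier
  numerator []       = 0#
  numerator (c ∷ as) = Σ (map (term (suc (length as))) (coarseningsOf c as))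

  weight-keep : ∀ n c γ → NonEmpty γ → weight (suc (suc n)) (c ∷ γ) ≈ y * weight (suc n) γ
  weight-keep n c (_ ∷ _) nonEmpty = *-assoc _ _ _

  weight-merge : ∀ n γ → length γ ≤ suc n → weight (suc (suc n)) γ ≈ z * weight (suc n) γ
  weight-merge n γ len≤ rewrite +-∸-assoc 1 len≤ = x*[y*z]≈y*[x*z] (pow y (length γ ∸ 1)) z _

  term-keep : ∀ n c γ → NonEmpty γ →
              term (suc (suc n)) (c ∷ γ) ≈ y * (x c * weight (suc n) γ + term (suc n) γ)
  term-keep n c γ ne = trans (*-congʳ (weight-keep n c γ ne))
    (solve 4 (λ Y W X S → (Y :* W) :* (X :+ S) := Y :* (X :* W :+ W :* S)) refl _ _ _ _)

  term-merge : ∀ n γ → length γ ≤ suc n → term (suc (suc n)) γ ≈ z * term (suc n) γ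
  term-merge n γ len≤ = trans (*-congʳ (weight-merge n γ len≤)) (*-assoc _ _ _)

  Σ-coarseningsOf-∷ : ∀ {F G K : List ℕ → Carrier} c a as →
    (∀ {γ} → γ ∈ coarseningsOf a as → F (c ∷ γ) ≈ y * G γ) →
    (∀ {γ} → γ ∈ coarseningsOf (c ℕ.+ a) as → F γ ≈ z * K γ) →
    Σ (map F (coarseningsOf c (a ∷ as))) ≈
      y * Σ (map G (coarseningsOf a as)) + z * Σ (map K (coarseningsOf (c ℕ.+ a) as))
  Σ-coarseningsOf-∷ {F} {G} {K} c a as keep merge = begin
    Σ (map F (map (c ∷_) kept ++ merged))          ≈⟨ Σ-++ F (map (c ∷_) kept) merged ⟩
    Σ (map F (map (c ∷_) kept)) + Σ (map F merged) ≡⟨ ≡.cong (λ l → Σ l + Σ (map F merged)) (map-∘ kept) ⟨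
    Σ (map (F ∘ (c ∷_)) kept) + Σ (map F merged)   ≈⟨ +-cong (Σ-cong kept keep) (Σ-cong merged merge) ⟩
    Σ (map (λ γ → y * G γ) kept) + Σ (map (λ γ → z * K γ) merged)
                                                   ≈⟨ +-cong (Σ-*ˡ y G kept) (Σ-*ˡ z K merged) ⟩
    y * Σ (map G kept) + z * Σ (map K merged)      ∎
    where
    kept = coarseningsOf a as
    merged = coarseningsOf (c ℕ.+ a) as

  Σweight-coarseningsOf : ∀ c as →
    Σ (map (weight (suc (length as))) (coarseningsOf c as)) ≈ pow (y + z) (length as)
  Σweight-coarseningsOf c []       = trans (+-identityʳ _) (*-identityˡ 1#)
  Σweight-coarseningsOf c (a ∷ as) = begin
    Σ (map (weight (suc (suc n))) (coarseningsOf c (a ∷ as)))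
      ≈⟨ Σ-coarseningsOf-∷ c a as
           (λ {γ} γ∈ → weight-keep n c γ (proj₁ (length-∈-coarseningsOf a as γ∈)))
           (λ {γ} γ∈ → weight-merge n γ (proj₂ (length-∈-coarseningsOf (c ℕ.+ a) as γ∈))) ⟩
    y * Σ (map (weight (suc n)) (coarseningsOf a as))
      + z * Σ (map (weight (suc n)) (coarseningsOf (c ℕ.+ a) as))
      ≈⟨ +-cong (*-congˡ (Σweight-coarseningsOf a as)) (*-congˡ (Σweight-coarseningsOf (c ℕ.+ a) as)) ⟩
    y * pow (y + z) n + z * pow (y + z) n
      ≈⟨ distribʳ _ y z ⟨
    (y + z) * pow (y + z) n ∎
    where n = length as

  numerator-[_] : ∀ c → numerator (c ∷ []) ≈ x c
  numerator-[ c ] = trans (+-identityʳ _) (trans (*-cong (*-identityˡ 1#) (+-identityʳ _)) (*-identityˡ _))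

  numerator-∷ : ∀ c δ → NonEmpty δ →
    numerator (c ∷ δ) ≈ y * (x c * pow (y + z) (length δ ∸ 1) + numerator δ) + z * numerator (addToHead c δ)
  numerator-∷ c (a ∷ as) nonEmpty = begin
    numerator (c ∷ a ∷ as)
      ≈⟨ Σ-coarseningsOf-∷ c a as
           (λ {γ} γ∈ → term-keep n c γ (proj₁ (length-∈-coarseningsOf a as γ∈)))
           (λ {γ} γ∈ → term-merge n γ (proj₂ (length-∈-coarseningsOf (c ℕ.+ a) as γ∈))) ⟩
    y * Σ (map (λ γ → x c * weight (suc n) γ + term (suc n) γ) kept) + z * numerator ((c ℕ.+ a) ∷ as)
      ≈⟨ +-congʳ (*-congˡ (Σ-+ (λ γ → x c * weight (suc n) γ) (term (suc n)) kept)) ⟩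
    y * (Σ (map (λ γ → x c * weight (suc n) γ) kept) + numerator (a ∷ as)) + z * numerator ((c ℕ.+ a) ∷ as)
      ≈⟨ +-congʳ (*-congˡ (+-congʳ (trans (Σ-*ˡ (x c) (weight (suc n)) kept)
                                          (*-congˡ (Σweight-coarseningsOf a as))))) ⟩
    y * (x c * pow (y + z) n + numerator (a ∷ as)) + z * numerator ((c ℕ.+ a) ∷ as) ∎
    where
    n = length as
    kept = coarseningsOf a as

  numerator-++ : ∀ c as b bs →
    numerator ((c ∷ as) ++ (b ∷ bs)) ≈
      y * (numerator (c ∷ as) * pow (y + z) (length bs) + pow (y + z) (length as) * numerator (b ∷ bs))
      + z * numerator ((c ∷ as) ⊙ (b ∷ bs))
  numerator-++ c [] b bs = begin
    numerator (c ∷ b ∷ bs)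
      ≈⟨ numerator-∷ c (b ∷ bs) nonEmpty ⟩
    y * (x c * P (length bs) + numerator (b ∷ bs)) + z * numerator ((c ℕ.+ b) ∷ bs)
      ≈⟨ +-congʳ (*-congˡ (+-cong (*-congʳ (sym numerator-[ c ])) (sym (*-identityˡ _)))) ⟩
    y * (numerator (c ∷ []) * P (length bs) + 1# * numerator (b ∷ bs)) + z * numerator ((c ℕ.+ b) ∷ bs) ∎
    where P = pow (y + z)
  numerator-++ c (a ∷ as) b bs = begin
    numerator (c ∷ a ∷ as ++ b ∷ bs)
      ≈⟨ numerator-∷ c (a ∷ as ++ b ∷ bs) nonEmpty ⟩
    y * (x c * P (length (as ++ b ∷ bs)) + numerator (a ∷ as ++ b ∷ bs))
      + z * numerator ((c ℕ.+ a) ∷ as ++ b ∷ bs)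
      ≈⟨ +-cong (*-congˡ (+-cong (*-congˡ (pow-length-++ (y + z) as (b ∷ bs))) (numerator-++ a as b bs)))
                (*-congˡ merged-++) ⟩
    y * (x c * (P (length as) * P (suc (length bs)))
         + (y * (numerator (a ∷ as) * P (length bs) + P (length as) * numerator (b ∷ bs)) + z * numerator δ))
      + z * (y * (numerator ((c ℕ.+ a) ∷ as) * P (length bs) + P (length as) * numerator (b ∷ bs))
             + z * numerator (addToHead c δ))
      ≈⟨ solve 10 (λ Y Z X Pa Pb Na Nb Nca Nδ Ncδ →
            Y :* (X :* (Pa :* ((Y :+ Z) :* Pb)) :+ (Y :* (Na :* Pb :+ Pa :* Nb) :+ Z :* Nδ))
              :+ Z :* (Y :* (Nca :* Pb :+ Pa :* Nb) :+ Z :* Ncδ)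
            := Y :* ((Y :* (X :* Pa :+ Na) :+ Z :* Nca) :* Pb :+ ((Y :+ Z) :* Pa) :* Nb)
              :+ Z :* (Y :* (X :* (Pa :* Pb) :+ Nδ) :+ Z :* Ncδ))
          refl y z (x c) (P (length as)) (P (length bs)) (numerator (a ∷ as)) (numerator (b ∷ bs))
               (numerator ((c ℕ.+ a) ∷ as)) (numerator δ) (numerator (addToHead c δ)) ⟩
    y * ((y * (x c * P (length as) + numerator (a ∷ as)) + z * numerator ((c ℕ.+ a) ∷ as)) * P (length bs)
         + P (suc (length as)) * numerator (b ∷ bs))
      + z * (y * (x c * (P (length as) * P (length bs)) + numerator δ) + z * numerator (addToHead c δ))
      ≈⟨ +-cong (*-congˡ (+-congʳ (*-congʳ (sym (numerator-∷ c (a ∷ as) nonEmpty)))))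
                (*-congˡ (sym (trans (numerator-∷ c δ (⊙-NonEmpty a as (b ∷ bs)))
                                     (+-congʳ (*-congˡ (+-congʳ (*-congˡ (pow-length-⊙ (y + z) a as b bs)))))))) ⟩
    y * (numerator (c ∷ a ∷ as) * P (length bs) + P (suc (length as)) * numerator (b ∷ bs))
      + z * numerator (c ∷ δ) ∎
    where
    P = pow (y + z)
    δ = (a ∷ as) ⊙ (b ∷ bs)
    merged-++ : numerator ((c ℕ.+ a) ∷ as ++ b ∷ bs) ≈
      y * (numerator ((c ℕ.+ a) ∷ as) * P (length bs) + P (length as) * numerator (b ∷ bs))
      + z * numerator (addToHead c δ)
    merged-++ rewrite addToHead-⊙ c a as (b ∷ bs) = numerator-++ (c ℕ.+ a) as b bs

  H-numerator : ∀ w δ → NonEmpty δ → Positive δ → H y z w x δ ≈ pow w (length δ ∸ 1) * numerator δ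
  H-numerator w (c ∷ as) nonEmpty (pc ∷ pas) = begin
    H y z w x (c ∷ as)
      ≈⟨ Σ-cong (coarsenings (c ∷ as)) (λ _ → x*y*z≈y*[x*z] _ _ _) ⟩
    Σ (map (λ γ → pow w n * term (suc n) γ) (coarsenings (c ∷ as)))
      ≈⟨ Σ-*ˡ (pow w n) (term (suc n)) (coarsenings (c ∷ as)) ⟩
    pow w n * Σ (map (term (suc n)) (coarsenings (c ∷ as)))
      ≈⟨ *-congˡ (Σ-↭ (term (suc n)) (coarsenings↭coarseningsOf c as pc pas)) ⟩
    pow w n * numerator (c ∷ as) ∎
    where n = length as

proposition6p1 : {c ℓ : Level} (R : CommutativeRing c ℓ) →
    let open CommutativeRing R in
    (y z w : Carrier) → w * (y + z) ≈ 1# → (x : ℕ → Carrier) →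
    (α β : List ℕ) → IsComposition α → IsComposition β →
    HDef.H R y z w x (α ++ β) ≈
      ((y * w) * (HDef.H R y z w x α + HDef.H R y z w x β)
        + (z * w) * HDef.H R y z w x (α ⊙ β))
proposition6p1 R y z w w[y+z]≈1 x (c ∷ as) (b ∷ bs) (nonEmpty , pc ∷ pas) (nonEmpty , pb ∷ pbs) = begin
  H y z w x ((c ∷ as) ++ (b ∷ bs))
    ≈⟨ H-numerator w ((c ∷ as) ++ (b ∷ bs)) nonEmpty (pc ∷ All.++⁺ pas (pb ∷ pbs)) ⟩
  pow w (length (as ++ b ∷ bs)) * N ((c ∷ as) ++ (b ∷ bs))
    ≈⟨ *-cong (pow-length-++ w as (b ∷ bs)) (numerator-++ c as b bs) ⟩
  (u * (w * v)) * (y * (N α * q + p * N β) + z * N α⊙β)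
    ≈⟨ rescale-by-inverses (pow-inverse w[y+z]≈1 (length as)) (pow-inverse w[y+z]≈1 (length bs))
                           w y z _ _ _ ⟩
  (y * w) * (u * N α + v * N β) + (z * w) * ((u * v) * N α⊙β)
    ≈⟨ +-cong (*-congˡ (+-cong (H-numerator w α nonEmpty (pc ∷ pas))
                               (H-numerator w β nonEmpty (pb ∷ pbs))))
              (*-congˡ (trans (H-numerator w α⊙β (⊙-NonEmpty c as β)
                                             (⊙-positive α β (pc ∷ pas) (pb ∷ pbs)))
                              (*-congʳ (pow-length-⊙ w c as b bs)))) ⟨
  (y * w) * (H y z w x α + H y z w x β) + (z * w) * H y z w x α⊙β ∎
  where
  open CommutativeRing R
  open HDef R using (pow; H)
  open Coarsening
  open RingSums R
  open Numerator R y z x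
  open Relation.Binary.Reasoning.Setoid setoid
  α = c ∷ as
  β = b ∷ bs
  α⊙β = α ⊙ β
  N = numerator
  u = pow w (length as)
  v = pow w (length bs)
  p = pow (y + z) (length as)
  q = pow (y + z) (length bs)
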